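{- Let $w\ge 4$, $h=\lfloor w/2\rfloor$, and let $m,n\in A_w$ with $p(m)=(\alpha^1,\alpha^2,\dots,\alpha^h)$, all $\alpha^s\ge 1$, $\alpha^1+\alpha^2\le 10$, and $p(n)=(10-\alpha^1,\alpha^2,\dots,\alpha^h)$. Then $K^2(m)=K^2(n)$.
   Context: A $w$-digit number is a string of $w$ decimal digits (leading zeros allowed); $A_w$ is the set of those whose digits are not all identical. For a $w$-digit number $n$, $O_d(n)=x_1\dots x_w$ is obtained by sorting its digits in non-increasing order and $O_u(n)=x_w\dots x_1$ by sorting them in non-decreasing order; the Kaprekar map is $K(n)=O_d(n)-O_u(n)$, written as a $w$-digit string with leading zeros, and $K^2=K\circ K$. The parameters of a $w$-digit number $n$ are $p(n)=(\alpha^1,\dots,\alpha^h)$, $\alpha^s=x_s-x_{w-s+1}$ where $x_1\ge\dots\ge x_w$ are its sorted digits. -}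

module Defs where

open import Data.Nat using (ℕ; zero; suc; _+_; _*_; _∸_; _≤_; _≤ᵇ_)
open import Data.Nat.DivMod using (_/_; _mod_)
open import Data.Fin using (Fin; toℕ)
open import Data.Vec using (Vec; []; _∷_; toList; lookup; reverse)
open import Data.List using (List; []; _∷_; map; upTo; foldl)
open import Data.Bool using (if_then_else_)
open import Data.Product using (∃₂)
open import Relation.Binary.PropositionalEquality using (_≢_)

-- A w-digit number: a string of w decimal digits (most significant first,
-- leading zeros allowed).
Digits : ℕ → Set
Digits w = Vec (Fin 10) w

A : (w : ℕ) → Digits w → Set
A w n = ∃₂ λ (i j : Fin w) → lookup n i ≢ lookup n j

insert : ℕ → List ℕ → List ℕ
insert x [] = x ∷ []
insert x (y ∷ ys) = if x ≤ᵇ y then x ∷ y ∷ ys else y ∷ insert x ys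

sortUp : List ℕ → List ℕ
sortUp [] = []
sortUp (x ∷ xs) = insert x (sortUp xs)

digitList : {w : ℕ} → Digits w → List ℕ
digitList n = map toℕ (toList n)

Ou : {w : ℕ} → Digits w → List ℕ
Ou n = sortUp (digitList n)

-- O_d(n) = x_1 ... x_w : digits sorted non-increasingly
Od : {w : ℕ} → Digits w → List ℕ
Od n = Data.List.reverse (Ou n)

value : List ℕ → ℕ
value = foldl (λ acc d → 10 * acc + d) 0

-- the w-digit string (with leading zeros) of x mod 10^w
-- least significant digit last
toDigitsLE : (w : ℕ) → ℕ → Vec (Fin 10) w
toDigitsLE zero x = []
toDigitsLE (suc w) x = (x mod 10) ∷ toDigitsLE w (x / 10)

toDigits : (w : ℕ) → ℕ → Digits w
toDigits w x = reverse (toDigitsLE w x)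

K : {w : ℕ} → Digits w → Digits w
K {w} n = toDigits w (value (Od n) ∸ value (Ou n))

K² : {w : ℕ} → Digits w → Digits w
K² n = K (K n)

-- list indexing with default 0 (indices used below are always in range)
nth : ℕ → List ℕ → ℕ
nth _ [] = 0
nth zero (x ∷ xs) = x
nth (suc i) (x ∷ xs) = nth i xs

-- α^s for s = 1..h, given with 0-based index i = s - 1:
-- α^{i+1} = x_{i+1} - x_{w-i}  (0-based: Od[i] - Od[w-1-i])
alpha : {w : ℕ} → Digits w → ℕ → ℕ
alpha {w} n i = nth i (Od n) ∸ nth (w ∸ 1 ∸ i) (Od n)

params : {w : ℕ} → Digits w → List ℕ
params {w} n = map (alpha n) (upTo (w / 2))

-- When every parameter is positive, O_d(n) − O_u(n) is a schoolbook subtraction whose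
-- borrows are forced, so its digits are determined by p(n) alone: least significant first
-- they are 10 − α¹, 9 − α², …, 9 − αʰ, (a 9 if w is odd), αʰ − 1, αʰ⁻¹, …, α¹. Replacing
-- α¹ by 10 − α¹ only exchanges the first and the last of these digits, so K(m) and K(n)
-- are digit permutations of each other, have the same sorted digits, and K²(m) = K²(n).
module Submission where

open import Defs
open import Data.Nat using (ℕ; zero; suc; _≤_; _<_; _+_; _*_; _∸_; _/_; _%_; _^_; _≤ᵇ_; z≤n; s≤s; s≤s⁻¹)
open import Data.Nat.Properties
open import Data.Nat.DivMod using (m/n≡1+[m∸n]/n; [m+kn]%n≡m%n; m<n⇒m%n≡m; +-distrib-/-∣ʳ; m<n⇒m/n≡0; m*n/n≡m; m/n≤m)
open import Data.Nat.Divisibility using (n∣m*n)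
open import Data.Nat.Tactic.RingSolver using (solve-∀)
open import Data.Fin using (toℕ)
open import Data.Fin.Properties using (toℕ<n; toℕ-fromℕ<)
open import Data.List using (List; []; _∷_; _∷ʳ_; length; map; foldr; reverse; drop; upTo; applyUpTo)
open import Function using (id)
open import Data.List.Properties using (length-++; length-map; length-reverse; length-applyUpTo; length-upTo; map-upTo; reverse-map; reverse-foldr; unfold-reverse; reverse-++)
open import Data.List.Reverse using (reverseView; _∶_∶ʳ_)
open import Data.List.Relation.Unary.All using (All; []; _∷_; universal)
open import Data.List.Relation.Unary.All.Properties using (map⁺; ++⁺; applyUpTo⁺₁)
open import Data.List.Relation.Binary.Permutation.Propositional as Perm using (_↭_; refl; prep; swap; ↭-sym; ↭-trans; module PermutationReasoning)
open import Data.List.Relation.Binary.Permutation.Propositional.Properties using (↭-length; All-resp-↭; ↭-reverse; ∷↭∷ʳ)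
open import Data.Vec as Vec using (toList)
open import Data.Vec.Properties using (toList-reverse; length-toList)
open import Data.Bool using (true; false)
open import Data.Empty using (⊥-elim)
open import Data.Product using (_×_; _,_; proj₂)
open import Relation.Nullary using (yes; no)
open import Relation.Nullary.Reflects using (ofʸ; ofⁿ)
open import Relation.Binary.Definitions using (tri<; tri≈; tri>)
open import Relation.Binary.PropositionalEquality using (_≡_; refl; sym; trans; cong; cong₂; subst; module ≡-Reasoning)

insert-≤ : ∀ {x y} l → x ≤ y → insert x (y ∷ l) ≡ x ∷ y ∷ l
insert-≤ {x} {y} l x≤y with x ≤ᵇ y | ≤ᵇ-reflects-≤ x y
... | true  | _       = refl
... | false | ofⁿ x≰y = ⊥-elim (x≰y x≤y)

insert-> : ∀ {x y} l → y < x → insert x (y ∷ l) ≡ y ∷ insert x l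
insert-> {x} {y} l y<x with x ≤ᵇ y | ≤ᵇ-reflects-≤ x y
... | true  | ofʸ x≤y = ⊥-elim (<⇒≱ y<x x≤y)
... | false | _       = refl

insert-comm-< : ∀ {x y} → x < y → ∀ l → insert x (insert y l) ≡ insert y (insert x l)
insert-comm-< {x} {y} x<y [] = begin
  insert x (y ∷ [])  ≡⟨ insert-≤ [] (<⇒≤ x<y) ⟩
  x ∷ y ∷ []         ≡⟨ sym (insert-> [] x<y) ⟩
  insert y (x ∷ [])  ∎
  where open ≡-Reasoning
insert-comm-< {x} {y} x<y (z ∷ l) with y ≤? z | x ≤? z
... | yes y≤z | _ = begin
  insert x (insert y (z ∷ l))  ≡⟨ cong (insert x) (insert-≤ l y≤z) ⟩
  insert x (y ∷ z ∷ l)         ≡⟨ insert-≤ (z ∷ l) (<⇒≤ x<y) ⟩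
  x ∷ y ∷ z ∷ l                ≡⟨ cong (x ∷_) (insert-≤ l y≤z) ⟨
  x ∷ insert y (z ∷ l)         ≡⟨ insert-> (z ∷ l) x<y ⟨
  insert y (x ∷ z ∷ l)         ≡⟨ cong (insert y) (insert-≤ l (<⇒≤ (<-≤-trans x<y y≤z))) ⟨
  insert y (insert x (z ∷ l))  ∎
  where open ≡-Reasoning
... | no y≰z | yes x≤z = begin
  insert x (insert y (z ∷ l))  ≡⟨ cong (insert x) (insert-> l (≰⇒> y≰z)) ⟩
  insert x (z ∷ insert y l)    ≡⟨ insert-≤ (insert y l) x≤z ⟩
  x ∷ z ∷ insert y l           ≡⟨ cong (x ∷_) (insert-> l (≰⇒> y≰z)) ⟨
  x ∷ insert y (z ∷ l)         ≡⟨ insert-> (z ∷ l) x<y ⟨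
  insert y (x ∷ z ∷ l)         ≡⟨ cong (insert y) (insert-≤ l x≤z) ⟨
  insert y (insert x (z ∷ l))  ∎
  where open ≡-Reasoning
... | no y≰z | no x≰z = begin
  insert x (insert y (z ∷ l))  ≡⟨ cong (insert x) (insert-> l (≰⇒> y≰z)) ⟩
  insert x (z ∷ insert y l)    ≡⟨ insert-> (insert y l) (≰⇒> x≰z) ⟩
  z ∷ insert x (insert y l)    ≡⟨ cong (z ∷_) (insert-comm-< x<y l) ⟩
  z ∷ insert y (insert x l)    ≡⟨ insert-> (insert x l) (≰⇒> y≰z) ⟨
  insert y (z ∷ insert x l)    ≡⟨ cong (insert y) (insert-> l (≰⇒> x≰z)) ⟨
  insert y (insert x (z ∷ l))  ∎
  where open ≡-Reasoning

insert-comm : ∀ x y l → insert x (insert y l) ≡ insert y (insert x l)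
insert-comm x y l with <-cmp x y
... | tri< x<y _ _ = insert-comm-< x<y l
... | tri≈ _ refl _ = refl
... | tri> _ _ y<x = sym (insert-comm-< y<x l)

insert-↭ : ∀ x l → insert x l ↭ x ∷ l
insert-↭ x [] = refl
insert-↭ x (y ∷ l) with x ≤ᵇ y
... | true  = refl
... | false = ↭-trans (prep y (insert-↭ x l)) (swap y x refl)

sortUp-↭ : ∀ l → sortUp l ↭ l
sortUp-↭ [] = refl
sortUp-↭ (x ∷ l) = ↭-trans (insert-↭ x (sortUp l)) (prep x (sortUp-↭ l))

sortUp-resp-↭ : ∀ {xs ys} → xs ↭ ys → sortUp xs ≡ sortUp ys
sortUp-resp-↭ refl = refl
sortUp-resp-↭ (prep x p) = cong (insert x) (sortUp-resp-↭ p)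
sortUp-resp-↭ (swap {xs} {ys} x y p) = begin
  insert x (insert y (sortUp xs))  ≡⟨ cong (λ s → insert x (insert y s)) (sortUp-resp-↭ p) ⟩
  insert x (insert y (sortUp ys))  ≡⟨ insert-comm x y (sortUp ys) ⟩
  insert y (insert x (sortUp ys))  ∎
  where open ≡-Reasoning
sortUp-resp-↭ (Perm.trans p q) = trans (sortUp-resp-↭ p) (sortUp-resp-↭ q)

-- The step function is `value`'s, flipped, so that `reverse-foldr` relates the two.
valueLE : List ℕ → ℕ
valueLE = foldr (λ d v → 10 * v + d) 0

value≡valueLE∘reverse : ∀ ds → value ds ≡ valueLE (reverse ds)
value≡valueLE∘reverse ds = sym (reverse-foldr (λ d v → 10 * v + d) 0 ds)

length-∷ʳ : ∀ (xs : List ℕ) x → length (xs ∷ʳ x) ≡ suc (length xs)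
length-∷ʳ xs x = trans (length-++ xs) (+-comm (length xs) 1)

valueLE-∷ʳ : ∀ ds d → valueLE (ds ∷ʳ d) ≡ valueLE ds + d * 10 ^ length ds
valueLE-∷ʳ [] d = sym (*-identityʳ d)
valueLE-∷ʳ (e ∷ ds) d rewrite valueLE-∷ʳ ds d = shift (valueLE ds) e d (10 ^ length ds)
  where
  shift : ∀ v e d p → 10 * (v + d * p) + e ≡ 10 * v + e + d * (10 * p)
  shift = solve-∀

module _ {d : ℕ} (v : ℕ) (d<10 : d < 10) where
  private
    d+v*10 : 10 * v + d ≡ d + v * 10
    d+v*10 = trans (+-comm (10 * v) d) (cong (d +_) (*-comm 10 v))

  [10*v+d]%10≡d : (10 * v + d) % 10 ≡ d
  [10*v+d]%10≡d = trans (cong (_% 10) d+v*10) (trans ([m+kn]%n≡m%n d v 10) (m<n⇒m%n≡m d<10))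

  [10*v+d]/10≡v : (10 * v + d) / 10 ≡ v
  [10*v+d]/10≡v = begin
    (10 * v + d) / 10       ≡⟨ cong (_/ 10) d+v*10 ⟩
    (d + v * 10) / 10       ≡⟨ +-distrib-/-∣ʳ d (n∣m*n v) ⟩
    d / 10 + v * 10 / 10    ≡⟨ cong₂ _+_ (m<n⇒m/n≡0 d<10) (m*n/n≡m v 10) ⟩
    v                       ∎
    where open ≡-Reasoning

toDigitsLE-valueLE : ∀ ds → All (_< 10) ds → map toℕ (toList (toDigitsLE (length ds) (valueLE ds))) ≡ ds
toDigitsLE-valueLE [] [] = refl
toDigitsLE-valueLE (d ∷ ds) (d<10 ∷ ds<10) = cong₂ _∷_
  (trans (toℕ-fromℕ< _) ([10*v+d]%10≡d (valueLE ds) d<10))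
  (trans (cong (λ v → map toℕ (toList (toDigitsLE (length ds) v))) ([10*v+d]/10≡v (valueLE ds) d<10))
         (toDigitsLE-valueLE ds ds<10))

NonzeroDigit : ℕ → Set
NonzeroDigit α = 0 < α × α < 10

complement-nonzero : ∀ {α} → NonzeroDigit α → NonzeroDigit (10 ∸ α)
complement-nonzero {suc t} (_ , α<10) = m<n⇒0<n∸m α<10 , s≤s (m∸n≤m 9 t)

[2+n]/2≡1+n/2 : ∀ n → (2 + n) / 2 ≡ suc (n / 2)
[2+n]/2≡1+n/2 n = m/n≡1+[m∸n]/n {2 + n} {2} (s≤s (s≤s z≤n))

-- differenceDigits (middle w) (α ∷ αs) is the digit list of O_d − O_u given in the header,
-- and body o α αs is that list without its lowest digit 10 − α.
middle : ℕ → List ℕ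
middle zero = []
middle (suc zero) = 9 ∷ []
middle (suc (suc k)) = middle k

body : List ℕ → ℕ → List ℕ → List ℕ
body o c [] = o ∷ʳ (c ∸ 1)
body o c (d ∷ αs) = (9 ∸ d) ∷ (body o d αs ∷ʳ c)

differenceDigits : List ℕ → List ℕ → List ℕ
differenceDigits o [] = []
differenceDigits o (α ∷ αs) = (10 ∸ α) ∷ body o α αs

length-middle : ∀ k → length (middle k) + 2 * (k / 2) ≡ k
length-middle zero = refl
length-middle (suc zero) = refl
length-middle (suc (suc k)) rewrite [2+n]/2≡1+n/2 k = begin
  length (middle k) + 2 * suc (k / 2)   ≡⟨ regroup (length (middle k)) (k / 2) ⟩
  2 + (length (middle k) + 2 * (k / 2)) ≡⟨ cong (2 +_) (length-middle k) ⟩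
  2 + k                                  ∎
  where
  open ≡-Reasoning
  regroup : ∀ m h → m + 2 * suc h ≡ 2 + (m + 2 * h)
  regroup = solve-∀

valueLE-middle : ∀ k → valueLE (middle k) + 1 ≡ 10 ^ length (middle k)
valueLE-middle zero = refl
valueLE-middle (suc zero) = refl
valueLE-middle (suc (suc k)) = valueLE-middle k

middle-<10 : ∀ k → All (_< 10) (middle k)
middle-<10 zero = []
middle-<10 (suc zero) = ≤-refl ∷ []
middle-<10 (suc (suc k)) = middle-<10 k

length-body : ∀ o c αs → length (body o c αs) ≡ suc (length o + 2 * length αs)
length-body o c [] = trans (length-∷ʳ o (c ∸ 1)) (cong suc (sym (+-identityʳ (length o))))
length-body o c (d ∷ αs) = begin
  suc (length (body o d αs ∷ʳ c))           ≡⟨ cong suc (length-∷ʳ (body o d αs) c) ⟩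
  suc (suc (length (body o d αs)))          ≡⟨ cong (λ n → suc (suc n)) (length-body o d αs) ⟩
  suc (suc (suc (length o + 2 * length αs))) ≡⟨ cong suc (regroup (length o) (length αs)) ⟩
  suc (length o + 2 * suc (length αs))      ∎
  where
  open ≡-Reasoning
  regroup : ∀ m n → suc (suc (m + 2 * n)) ≡ m + 2 * suc n
  regroup = solve-∀

length-body-middle : ∀ k c αs → length αs ≡ k / 2 → length (body (middle k) c αs) ≡ suc k
length-body-middle k c αs ℓ = begin
  length (body (middle k) c αs)               ≡⟨ length-body (middle k) c αs ⟩
  suc (length (middle k) + 2 * length αs)     ≡⟨ cong (λ n → suc (length (middle k) + 2 * n)) ℓ ⟩
  suc (length (middle k) + 2 * (k / 2))       ≡⟨ cong suc (length-middle k) ⟩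
  suc k                                       ∎
  where open ≡-Reasoning

length-differenceDigits : ∀ k αs → length αs ≡ (2 + k) / 2 → length (differenceDigits (middle (2 + k)) αs) ≡ 2 + k
length-differenceDigits k [] ℓ with () ← trans ℓ ([2+n]/2≡1+n/2 k)
length-differenceDigits k (α ∷ αs) ℓ =
  cong suc (length-body-middle k α αs (suc-injective (trans ℓ ([2+n]/2≡1+n/2 k))))

body-<10 : ∀ {o c αs} → All (_< 10) o → All NonzeroDigit (c ∷ αs) → All (_< 10) (body o c αs)
body-<10 {c = c} o<10 ((_ , c<10) ∷ []) = ++⁺ o<10 (≤-<-trans (m∸n≤m c 1) c<10 ∷ [])
body-<10 {αs = d ∷ _} o<10 ((_ , c<10) ∷ ds) = s≤s (m∸n≤m 9 d) ∷ ++⁺ (body-<10 o<10 ds) (c<10 ∷ [])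

differenceDigits-<10 : ∀ {o αs} → All (_< 10) o → All NonzeroDigit αs → All (_< 10) (differenceDigits o αs)
differenceDigits-<10 o<10 [] = []
differenceDigits-<10 o<10 αs@(α ∷ _) = proj₂ (complement-nonzero α) ∷ body-<10 o<10 αs

valueLE-differenceDigits-∷ : ∀ {o} → valueLE o + 1 ≡ 10 ^ length o → ∀ {α αs} → All NonzeroDigit (α ∷ αs) →
  valueLE (differenceDigits o (α ∷ αs)) + α ≡ 10 * valueLE (differenceDigits o αs) + α * 10 ^ length (body o α αs)
valueLE-differenceDigits-∷ {o} nines {suc t} {[]} ((_ , α<10) ∷ []) = begin
  10 * valueLE (o ∷ʳ t) + (9 ∸ t) + suc t       ≡⟨ +-assoc (10 * valueLE (o ∷ʳ t)) (9 ∸ t) (suc t) ⟩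
  10 * valueLE (o ∷ʳ t) + (9 ∸ t + suc t)       ≡⟨ cong₂ (λ v e → 10 * v + e) (valueLE-∷ʳ o t) (m∸n+n≡m (<⇒≤ α<10)) ⟩
  10 * (valueLE o + t * P) + 10                 ≡⟨ regroup (valueLE o) t P ⟩
  10 * (valueLE o + 1) + 10 * t * P             ≡⟨ cong (λ v → 10 * v + 10 * t * P) nines ⟩
  10 * P + 10 * t * P                           ≡⟨ collect t P ⟩
  suc t * 10 ^ suc (length o)                   ≡⟨ cong (λ n → suc t * 10 ^ n) (length-∷ʳ o t) ⟨
  suc t * 10 ^ length (o ∷ʳ t)                  ∎
  where
  open ≡-Reasoning
  P = 10 ^ length o
  regroup : ∀ v t p → 10 * (v + t * p) + 10 ≡ 10 * (v + 1) + 10 * t * p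
  regroup = solve-∀
  collect : ∀ t p → 10 * p + 10 * t * p ≡ suc t * (10 * p)
  collect = solve-∀
valueLE-differenceDigits-∷ {o} nines {α} {c ∷ αs} ((_ , α<10) ∷ (_ , c<10) ∷ _) = begin
  10 * (10 * valueLE (B ∷ʳ α) + (9 ∸ c)) + (10 ∸ α) + α
    ≡⟨ +-assoc (10 * (10 * valueLE (B ∷ʳ α) + (9 ∸ c))) (10 ∸ α) α ⟩
  10 * (10 * valueLE (B ∷ʳ α) + (9 ∸ c)) + (10 ∸ α + α)
    ≡⟨ cong₂ (λ v e → 10 * (10 * v + (9 ∸ c)) + e) (valueLE-∷ʳ B α) (m∸n+n≡m (<⇒≤ α<10)) ⟩
  10 * (10 * (valueLE B + α * P) + (9 ∸ c)) + 10
    ≡⟨ regroup (valueLE B) α P (9 ∸ c) ⟩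
  10 * (10 * valueLE B + suc (9 ∸ c)) + α * (10 * (10 * P))
    ≡⟨ cong₂ (λ e n → 10 * (10 * valueLE B + e) + α * (10 * 10 ^ n)) (+-∸-assoc 1 (s≤s⁻¹ c<10)) (length-∷ʳ B α) ⟨
  10 * (10 * valueLE B + (10 ∸ c)) + α * (10 * 10 ^ length (B ∷ʳ α))
    ∎
  where
  open ≡-Reasoning
  B = body o c αs
  P = 10 ^ length B
  regroup : ∀ v α p e → 10 * (10 * (v + α * p) + e) + 10 ≡ 10 * (10 * v + suc e) + α * (10 * (10 * p))
  regroup = solve-∀

reverse-shell : ∀ (a : ℕ) mid b → reverse (a ∷ mid ∷ʳ b) ≡ b ∷ (reverse mid ∷ʳ a)
reverse-shell a mid b = trans (unfold-reverse a (mid ∷ʳ b)) (cong (_∷ʳ a) (reverse-++ mid (b ∷ [])))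

-- The outer digits a = b + α contribute α · 10 ^ (k + 1) − α to the difference, the interior 10 · D′.
valueLE-shell : ∀ a b mid {D D′} → b ≤ a →
  D + (a ∸ b) ≡ 10 * D′ + (a ∸ b) * 10 ^ suc (length mid) →
  valueLE mid + D′ ≡ valueLE (reverse mid) →
  valueLE (a ∷ mid ∷ʳ b) + D ≡ valueLE (reverse (a ∷ mid ∷ʳ b))
valueLE-shell a b mid {D} {D′} b≤a outer inner = begin
  10 * valueLE (mid ∷ʳ b) + a + D              ≡⟨ cong (λ v → 10 * v + a + D) (valueLE-∷ʳ mid b) ⟩
  10 * (M + b * P) + a + D                      ≡⟨ cong (λ a′ → 10 * (M + b * P) + a′ + D) a≡b+α ⟨
  10 * (M + b * P) + (b + α) + D                ≡⟨ +-cancelʳ-≡ α _ _ borrow ⟩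
  10 * (valueLE (reverse mid) + (b + α) * P) + b  ≡⟨ cong (λ a′ → 10 * (valueLE (reverse mid) + a′ * P) + b) a≡b+α ⟩
  10 * (valueLE (reverse mid) + a * P) + b      ≡⟨ cong (λ n → 10 * (valueLE (reverse mid) + a * 10 ^ n) + b) (length-reverse mid) ⟨
  10 * (valueLE (reverse mid) + a * 10 ^ length (reverse mid)) + b
                                                ≡⟨ cong (λ v → 10 * v + b) (valueLE-∷ʳ (reverse mid) a) ⟨
  valueLE (b ∷ (reverse mid ∷ʳ a))              ≡⟨ cong valueLE (reverse-shell a mid b) ⟨
  valueLE (reverse (a ∷ mid ∷ʳ b))              ∎
  where
  open ≡-Reasoning
  M = valueLE mid
  P = 10 ^ length mid
  α = a ∸ b
  a≡b+α : b + α ≡ a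
  a≡b+α = m+[n∸m]≡n b≤a
  borrow : 10 * (M + b * P) + (b + α) + D + α ≡ 10 * (valueLE (reverse mid) + (b + α) * P) + b + α
  borrow = begin
    10 * (M + b * P) + (b + α) + D + α        ≡⟨ +-assoc (10 * (M + b * P) + (b + α)) D α ⟩
    10 * (M + b * P) + (b + α) + (D + α)      ≡⟨ cong (10 * (M + b * P) + (b + α) +_) outer ⟩
    10 * (M + b * P) + (b + α) + (10 * D′ + α * (10 * P))  ≡⟨ regroup M D′ b α P ⟩
    10 * ((M + D′) + (b + α) * P) + b + α     ≡⟨ cong (λ v → 10 * (v + (b + α) * P) + b + α) inner ⟩
    10 * (valueLE (reverse mid) + (b + α) * P) + b + α ∎
    where
    regroup : ∀ m d b α p → 10 * (m + b * p) + (b + α) + (10 * d + α * (10 * p)) ≡ 10 * ((m + d) + (b + α) * p) + b + α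
    regroup = solve-∀

gaps : ℕ → List ℕ → List ℕ
gaps w x = applyUpTo (λ i → nth i x ∸ nth (w ∸ 1 ∸ i) x) (w / 2)

nth-∷ʳ-< : ∀ {i} xs (y : ℕ) → i < length xs → nth i (xs ∷ʳ y) ≡ nth i xs
nth-∷ʳ-< {zero} (x ∷ xs) y _ = refl
nth-∷ʳ-< {suc i} (x ∷ xs) y i<n = nth-∷ʳ-< xs y (s≤s⁻¹ i<n)

nth-∷ʳ-length : ∀ xs (y : ℕ) → nth (length xs) (xs ∷ʳ y) ≡ y
nth-∷ʳ-length [] y = refl
nth-∷ʳ-length (x ∷ xs) y = nth-∷ʳ-length xs y

applyUpTo-cong-< : ∀ {f g : ℕ → ℕ} n → (∀ {i} → i < n → f i ≡ g i) → applyUpTo f n ≡ applyUpTo g n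
applyUpTo-cong-< zero _ = refl
applyUpTo-cong-< (suc n) f≗g = cong₂ _∷_ (f≗g (s≤s z≤n)) (applyUpTo-cong-< n (λ i<n → f≗g (s≤s i<n)))

gaps-shell : ∀ a mid b → gaps (2 + length mid) (a ∷ mid ∷ʳ b) ≡ (a ∸ b) ∷ gaps (length mid) mid
gaps-shell a mid b rewrite [2+n]/2≡1+n/2 (length mid) =
  cong₂ _∷_ (cong (a ∸_) (nth-∷ʳ-length mid b)) (applyUpTo-cong-< (k / 2) inner)
  where
  k = length mid
  inner : ∀ {i} → i < k / 2 → nth i (mid ∷ʳ b) ∸ nth (k ∸ i) (a ∷ mid ∷ʳ b) ≡ nth i mid ∸ nth (k ∸ 1 ∸ i) mid
  inner {i} i<k/2 = cong₂ _∸_ (nth-∷ʳ-< mid b i<k) (begin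
    nth (k ∸ i) (a ∷ mid ∷ʳ b)       ≡⟨ cong (λ j → nth j (a ∷ mid ∷ʳ b)) (+-∸-assoc 1 i<k) ⟩
    nth (k ∸ suc i) (mid ∷ʳ b)       ≡⟨ nth-∷ʳ-< mid b (∸-monoʳ-< {k} (s≤s z≤n) i<k) ⟩
    nth (k ∸ suc i) mid              ≡⟨ cong (λ j → nth j mid) (∸-+-assoc k 1 i) ⟨
    nth (k ∸ 1 ∸ i) mid              ∎)
    where
    open ≡-Reasoning
    i<k : i < k
    i<k = <-≤-trans i<k/2 (m/n≤m k 2)

valueLE-differenceDigits : ∀ k x → length x ≡ k → All NonzeroDigit (gaps k x) →
  valueLE x + valueLE (differenceDigits (middle k) (gaps k x)) ≡ valueLE (reverse x)
valueLE-differenceDigits zero [] refl _ = refl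
valueLE-differenceDigits (suc zero) (c ∷ []) refl _ = +-identityʳ c
valueLE-differenceDigits (suc (suc k)) (a ∷ y) ℓ nonzero with reverseView y
... | mid ∶ _ ∶ʳ b =
  subst (λ gs → valueLE (a ∷ mid ∷ʳ b) + valueLE (differenceDigits (middle k) gs) ≡ valueLE (reverse (a ∷ mid ∷ʳ b)))
    (sym shell) (peel (subst (All NonzeroDigit) shell nonzero))
  where
  ℓmid : length mid ≡ k
  ℓmid = suc-injective (trans (sym (length-∷ʳ mid b)) (suc-injective ℓ))
  shell : gaps (2 + k) (a ∷ mid ∷ʳ b) ≡ (a ∸ b) ∷ gaps k mid
  shell = subst (λ k → gaps (2 + k) (a ∷ mid ∷ʳ b) ≡ (a ∸ b) ∷ gaps k mid) ℓmid (gaps-shell a mid b)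
  peel : All NonzeroDigit ((a ∸ b) ∷ gaps k mid) →
    valueLE (a ∷ mid ∷ʳ b) + valueLE (differenceDigits (middle k) ((a ∸ b) ∷ gaps k mid)) ≡ valueLE (reverse (a ∷ mid ∷ʳ b))
  peel all@((α>0 , _) ∷ inner) = valueLE-shell a b mid (<⇒≤ (m∸n≢0⇒n<m (>⇒≢ α>0)))
    (trans (valueLE-differenceDigits-∷ (valueLE-middle k) all)
      (cong (λ n → 10 * valueLE (differenceDigits (middle k) (gaps k mid)) + (a ∸ b) * 10 ^ n)
        (trans (length-body-middle k (a ∸ b) (gaps k mid) (length-applyUpTo _ (k / 2))) (cong suc (sym ℓmid)))))
    (valueLE-differenceDigits k mid ℓmid inner)

nth-All : ∀ {P : ℕ → Set} {l} → P 0 → All P l → ∀ i → P (nth i l)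
nth-All p0 [] i = p0
nth-All p0 (p ∷ _) zero = p
nth-All p0 (_ ∷ ps) (suc i) = nth-All p0 ps i

Od-↭ : ∀ {w} (d : Digits w) → Od d ↭ digitList d
Od-↭ d = ↭-trans (↭-reverse (Ou d)) (sortUp-↭ (digitList d))

length-Od : ∀ {w} (d : Digits w) → length (Od d) ≡ w
length-Od d = trans (↭-length (Od-↭ d)) (trans (length-map toℕ (toList d)) (length-toList d))

Od-<10 : ∀ {w} (d : Digits w) → All (_< 10) (Od d)
Od-<10 d = All-resp-↭ (↭-sym (Od-↭ d)) (map⁺ (universal toℕ<n (toList d)))

params≡gaps : ∀ {w} (d : Digits w) → params d ≡ gaps w (Od d)
params≡gaps {w} d = map-upTo (alpha d) (w / 2)

params-nonzero : ∀ {w} (d : Digits w) → (∀ i → i < w / 2 → 1 ≤ alpha d i) → All NonzeroDigit (params d)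
params-nonzero {w} d pos = map⁺ (applyUpTo⁺₁ id (w / 2) λ {i} i<h →
  pos i i<h , ≤-<-trans (m∸n≤m (nth i (Od d)) (nth (w ∸ 1 ∸ i) (Od d))) (nth-All (s≤s z≤n) (Od-<10 d) i))

value-Od∸value-Ou : ∀ {w} (d : Digits w) → All NonzeroDigit (params d) →
  value (Od d) ∸ value (Ou d) ≡ valueLE (differenceDigits (middle w) (params d))
value-Od∸value-Ou {w} d nonzero rewrite params≡gaps d = begin
  value (Od d) ∸ value (Ou d)
    ≡⟨ cong₂ _∸_ (value≡valueLE∘reverse (Od d)) (value≡valueLE∘reverse (Ou d)) ⟩
  valueLE (reverse (Od d)) ∸ valueLE (Od d)
    ≡⟨ cong (_∸ valueLE (Od d)) (valueLE-differenceDigits w (Od d) (length-Od d) nonzero) ⟨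
  valueLE (Od d) + valueLE (differenceDigits (middle w) (gaps w (Od d))) ∸ valueLE (Od d)
    ≡⟨ m+n∸m≡n (valueLE (Od d)) _ ⟩
  valueLE (differenceDigits (middle w) (gaps w (Od d))) ∎
  where open ≡-Reasoning

digitList-K : ∀ k (d : Digits (2 + k)) → All NonzeroDigit (params d) →
  digitList (K d) ≡ reverse (differenceDigits (middle (2 + k)) (params d))
digitList-K k d nonzero = begin
  map toℕ (toList (Vec.reverse (toDigitsLE w difference)))
    ≡⟨ cong (map toℕ) (toList-reverse (toDigitsLE w difference)) ⟩
  map toℕ (reverse (toList (toDigitsLE w difference)))
    ≡⟨ reverse-map toℕ (toList (toDigitsLE w difference)) ⟩
  reverse (map toℕ (toList (toDigitsLE w difference)))
    ≡⟨ cong₂ (λ n v → reverse (map toℕ (toList (toDigitsLE n v)))) (sym ℓD) (value-Od∸value-Ou d nonzero) ⟩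
  reverse (map toℕ (toList (toDigitsLE (length D) (valueLE D))))
    ≡⟨ cong reverse (toDigitsLE-valueLE D (differenceDigits-<10 (middle-<10 w) nonzero)) ⟩
  reverse D ∎
  where
  open ≡-Reasoning
  w = 2 + k
  difference = value (Od d) ∸ value (Ou d)
  D = differenceDigits (middle w) (params d)
  ℓD : length D ≡ w
  ℓD = length-differenceDigits k (params d) (trans (length-map (alpha d) (upTo (w / 2))) (length-upTo (w / 2)))

K-resp-Ou : ∀ {w} {a b : Digits w} → Ou a ≡ Ou b → K a ≡ K b
K-resp-Ou {w} = cong (λ L → toDigits w (value (reverse L) ∸ value L))

↭-swap-ends : ∀ (s t : ℕ) xs → s ∷ (xs ∷ʳ t) ↭ t ∷ (xs ∷ʳ s)
↭-swap-ends s t xs = begin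
  s ∷ (xs ∷ʳ t)  ↭⟨ prep s (∷↭∷ʳ t xs) ⟨
  s ∷ t ∷ xs     ↭⟨ swap s t refl ⟩
  t ∷ s ∷ xs     ↭⟨ prep t (∷↭∷ʳ s xs) ⟩
  t ∷ (xs ∷ʳ s)  ∎
  where open PermutationReasoning

differenceDigits-complement-↭ : ∀ o {α} c αs → α ≤ 10 →
  differenceDigits o (α ∷ c ∷ αs) ↭ differenceDigits o ((10 ∸ α) ∷ c ∷ αs)
differenceDigits-complement-↭ o {α} c αs α≤10 rewrite m∸[m∸n]≡n α≤10 =
  ↭-swap-ends (10 ∸ α) α ((9 ∸ c) ∷ body o c αs)

K²-complement : ∀ k (m n : Digits (2 + k)) {α c αs} →
  params m ≡ α ∷ c ∷ αs → params n ≡ (10 ∸ α) ∷ c ∷ αs → All NonzeroDigit (params m) → K² m ≡ K² n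
K²-complement k m n {α} {c} {αs} pm pn nonzero-m = K-resp-Ou {a = K m} {K n} (sortUp-resp-↭ (begin
  digitList (K m)                    ≡⟨ digitList-K k m nonzero-m ⟩
  reverse (D (params m))             ↭⟨ ↭-reverse (D (params m)) ⟩
  D (params m)                       ≡⟨ cong D pm ⟩
  D (α ∷ c ∷ αs)                     ↭⟨ differenceDigits-complement-↭ (middle (2 + k)) c αs (<⇒≤ α<10) ⟩
  D ((10 ∸ α) ∷ c ∷ αs)              ≡⟨ cong D pn ⟨
  D (params n)                       ↭⟨ ↭-reverse (D (params n)) ⟨
  reverse (D (params n))             ≡⟨ digitList-K k n nonzero-n ⟨
  digitList (K n)                    ∎))
  where
  open PermutationReasoning
  D = differenceDigits (middle (2 + k))
  α-nonzero,rest : All NonzeroDigit (α ∷ c ∷ αs)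
  α-nonzero,rest = subst (All NonzeroDigit) pm nonzero-m
  α<10 : α < 10
  α<10 with (_ , α<10) ∷ _ ← α-nonzero,rest = α<10
  nonzero-n : All NonzeroDigit (params n)
  nonzero-n with α-nonzero ∷ rest ← α-nonzero,rest = subst (All NonzeroDigit) (sym pn) (complement-nonzero α-nonzero ∷ rest)

params-∷-∷ : ∀ j (d : Digits (4 + j)) → params d ≡ alpha d 0 ∷ alpha d 1 ∷ drop 2 (params d)
params-∷-∷ j d = begin
  map (alpha d) (upTo ((4 + j) / 2))                ≡⟨ cong (λ h → map (alpha d) (upTo h)) quarter ⟩
  map (alpha d) (upTo (2 + j / 2))                  ≡⟨ cong (λ h → alpha d 0 ∷ alpha d 1 ∷ drop 2 (map (alpha d) (upTo h))) quarter ⟨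
  alpha d 0 ∷ alpha d 1 ∷ drop 2 (params d)         ∎
  where
  open ≡-Reasoning
  quarter : (4 + j) / 2 ≡ 2 + j / 2
  quarter = trans ([2+n]/2≡1+n/2 (2 + j)) (cong suc ([2+n]/2≡1+n/2 j))

mainTheorem10 : (w : ℕ) → 4 ≤ w → (m n : Digits w) → A w m → A w n
    → (∀ i → i < w / 2 → 1 ≤ alpha m i)
    → alpha m 0 + alpha m 1 ≤ 10
    → params n ≡ (10 ∸ alpha m 0) ∷ drop 1 (params m)
    → K² m ≡ K² n
mainTheorem10 (suc (suc (suc (suc j)))) (s≤s (s≤s (s≤s (s≤s _)))) m n _ _ positive _ pn =
  K²-complement (2 + j) m n shape (trans pn (cong (λ ps → 10 ∸ alpha m 0 ∷ drop 1 ps) shape)) (params-nonzero m positive)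
  where
  shape : params m ≡ alpha m 0 ∷ alpha m 1 ∷ drop 2 (params m)
  shape = params-∷-∷ j m
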